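{- There is an absolute constant $C>0$ such that for every positive integer $d$, every finite simple graph $G$ that is triangle-free and $d$-degenerate has Hall ratio $\rho(G) \le C\, d/\log d$.
   Context: Here $\log$ denotes the truncated logarithm: $\log(x) = \ln(x)$ if $x>e$ and $\log(x)=1$ if $x \le e$. A graph is $d$-degenerate if every nonempty subgraph has a vertex of degree at most $d$. The Hall ratio is $\rho(G) = \sup_{U} |U|/\alpha(G[U])$, the supremum over nonempty vertex subsets $U$, where $G[U]$ is the induced subgraph and $\alpha$ is the independence number. -}

module Defs where

open import Data.Nat using (ℕ; zero; suc; _+_; _*_; _^_; _≤_; _<_; _!)

open import Data.Bool using (Bool; true; false; T; _∧_)
open import Data.Fin using (Fin)
open import Data.Fin.Subset using (Subset; _∈_; _⊆_; ∣_∣; Nonempty)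
open import Data.Vec using (tabulate; lookup)
open import Data.Product using (Σ; ∃; _×_; _,_)
open import Relation.Binary.PropositionalEquality using (_≡_)
open import Relation.Nullary using (¬_)

record SimpleGraph (n : ℕ) : Set where
  field
    adj    : Fin n → Fin n → Bool
    sym    : ∀ u v → adj u v ≡ adj v u
    irrefl : ∀ v → adj v v ≡ false
open SimpleGraph public

TriangleFree : ∀ {n} → SimpleGraph n → Set
TriangleFree G =
  ¬ (Σ _ λ u → Σ _ λ v → Σ _ λ w →
       T (adj G u v) × T (adj G v w) × T (adj G u w))

-- A subgraph of G: a vertex set S together with a symmetric edge
-- relation H contained in the edges of G.  The degree of v in (S , H)
-- is the number of u ∈ S with H v u.
subDegree : ∀ {n} → Subset n → (Fin n → Fin n → Bool) → Fin n → ℕ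
subDegree S H v = ∣ tabulate (λ u → lookup S u ∧ H v u) ∣

Degenerate : ∀ {n} → ℕ → SimpleGraph n → Set
Degenerate {n} d G =
  (S : Subset n) (H : Fin n → Fin n → Bool) →
  (∀ u v → T (H u v) → T (adj G u v)) →
  (∀ u v → H u v ≡ H v u) →
  Nonempty S →
  Σ (Fin n) λ v → v ∈ S × subDegree S H v ≤ d

IndependentIn : ∀ {n} → SimpleGraph n → Subset n → Subset n → Set
IndependentIn G U I = I ⊆ U × (∀ u v → u ∈ I → v ∈ I → adj G u v ≡ false)

IsIndependenceNumber : ∀ {n} → SimpleGraph n → Subset n → ℕ → Set
IsIndependenceNumber G U a =
  (Σ _ λ I → IndependentIn G U I × ∣ I ∣ ≡ a) ×
  (∀ I → IndependentIn G U I → ∣ I ∣ ≤ a)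

-- expSum m N = N! * Σ_{k=0}^{N} m^k / k!   (a natural number)
expSum : ℕ → ℕ → ℕ
expSum m zero    = 1
expSum m (suc N) = suc N * expSum m N + m ^ suc N

-- The real inequality  x · log d ≤ m  (x, d, m naturals), with log the
-- truncated logarithm: log d = 1 for d ≤ 2 (i.e. d ≤ e), ln d otherwise.
-- For d ≥ 3:  x ln d ≤ m  ⇔  d^x ≤ e^m = sup_N Σ_{k≤N} m^k/k!
--            ⇔  ∃ N, d^x · N! ≤ expSum m N
-- (the supremum is attained only if m = 0, and e^m ∉ ℕ for m ≥ 1).
MulLogLe : ℕ → ℕ → ℕ → Set
MulLogLe x d m with d
... | zero             = x ≤ m
... | suc zero         = x ≤ m
... | suc (suc zero)   = x ≤ m
... | suc (suc (suc _)) = ∃ λ N → d ^ x * (N !) ≤ expSum m N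

{-# OPTIONS --safe #-}
module Submission where

-- Shearer's argument, run on the low-degree half of U.  A d-degenerate graph has average degree at
-- most 2d, so the vertices of U of degree at most D = 4d in G[U] form a set W with |U| ≤ 2|W|.
-- Let f(0) = 1 and (k² + 1) f(k) = 1 + k(k − 1) f(k − 1); f is decreasing and convex.  For the
-- potential Φ(W) = Σ_{u ∈ W} f(deg_W u) of a triangle-free graph of maximum degree D, averaging
-- Φ(W) − Φ(W ∖ N[v]) over v ∈ W gives at most 1: the neighbours of v contribute through the
-- recurrence, the non-neighbours through the common neighbours they lose, and triangle-freeness
-- together with the convexity of f makes the two balance.  Removing such closed neighbourhoods
-- greedily builds an independent set of size at least Φ(W) ≥ |W| f(D).  Finally D f(D) grows by at
-- least 1/(2(m+1)) from m to m + 1, so f(D) ≥ (J + 1)/(4D) when 2^J ≤ D < 2^(J+1); hence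
-- (J + 1) |U| ≤ 32 d α(G[U]), and log d ≤ (J + 1) log 2 turns this into the statement.

open import Defs hiding (sym)
open import Data.Bool using (Bool; true; false; T; _∧_; _∨_; not)
open import Data.Bool.Properties using (T-∧; T-∨; T-≡)
open import Data.Empty using (⊥; ⊥-elim)
open import Data.Fin using (Fin; zero; suc)
open import Data.Fin.Properties using (_≟_; any?)
open import Data.Fin.Subset using (Subset; ∣_∣; Nonempty)
import Data.Fin.Subset as Subset
open import Data.Nat hiding (_≟_)
open import Data.Nat.Properties hiding (_≟_)
open import Data.Nat.Tactic.RingSolver using (solve-∀)
open import Algebra.Properties.CommutativeSemigroup *-commutativeSemigroup using (x∙yz≈y∙xz)
open import Algebra.Properties.Semiring.Sum +-*-semiring
  using (sum; sum-cong-≗; ∑-distrib-+; ∑-comm; *-distribˡ-sum; *-distribʳ-sum; sum-replicate-zero)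
open import Data.Product using (Σ; ∃; ∃₂; _×_; _,_; proj₁; proj₂)
open import Data.Sum using (_⊎_; inj₁; inj₂)
open import Data.Vec using ([]; _∷_; tabulate; lookup)
open import Data.Vec.Properties using (lookup∘tabulate; []=⇒lookup; lookup⇒[]=)
open import Function using (_∘_)
open import Function.Bundles using (Equivalence)
open import Relation.Binary.PropositionalEquality
open import Relation.Nullary using (¬_; yes; no; does)
open import Relation.Nullary.Decidable using (T?; _×-dec_)

private
  variable
    n : ℕ

-- Vertex sets and sums over them

∧-fst : ∀ {x y} → T (x ∧ y) → T x
∧-fst = proj₁ ∘ Equivalence.to T-∧

∧-snd : ∀ {x y} → T (x ∧ y) → T y
∧-snd = proj₂ ∘ Equivalence.to T-∧

T-not⇒¬T : ∀ {b} → T (not b) → ¬ T b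
T-not⇒¬T {true} ()

𝟙 : Bool → ℕ
𝟙 true  = 1
𝟙 false = 0

sum-mono-≤ : {f g : Fin n → ℕ} → (∀ i → f i ≤ g i) → sum f ≤ sum g
sum-mono-≤ {zero}  f≤g = z≤n
sum-mono-≤ {suc n} f≤g = +-mono-≤ (f≤g zero) (sum-mono-≤ (f≤g ∘ suc))

VSet : ℕ → Set
VSet n = Fin n → Bool

infixr 7 _∩_
infixr 6 _∪_
infixl 6 _∖_
infix  4 _⊆_

_∩_ _∪_ _∖_ : VSet n → VSet n → VSet n
(V ∩ W) u = V u ∧ W u
(V ∪ W) u = V u ∨ W u
(V ∖ W) u = V u ∧ not (W u)

∁ : VSet n → VSet n
∁ W u = not (W u)

⁅_⁆ : Fin n → VSet n
⁅ v ⁆ u = does (u ≟ v)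

_⊆_ : VSet n → VSet n → Set
V ⊆ W = ∀ {u} → T (V u) → T (W u)

Disjoint : VSet n → VSet n → Set
Disjoint V W = ∀ {u} → T (V u) → T (W u) → ⊥

Symmetric : (Fin n → VSet n) → Set
Symmetric R = ∀ u v → R u v ≡ R v u

∑∈ : VSet n → (Fin n → ℕ) → ℕ
∑∈ W f = sum (λ u → 𝟙 (W u) * f u)

infixl 10 ∑∈
syntax ∑∈ W (λ u → x) = ∑[ u ∈ W ] x

size : VSet n → ℕ
size W = ∑[ u ∈ W ] 1

∈⁅⁆⇒≡ : ∀ {u v : Fin n} → T (⁅ v ⁆ u) → u ≡ v
∈⁅⁆⇒≡ {u = u} {v} u∈⁅v⁆ with u ≟ v
... | yes u≡v = u≡v

v∈⁅v⁆ : (v : Fin n) → T (⁅ v ⁆ v)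
v∈⁅v⁆ v with v ≟ v
... | yes _   = _
... | no  v≢v = v≢v refl

⁅⁆-sym : (u v : Fin n) → ⁅ v ⁆ u ≡ ⁅ u ⁆ v
⁅⁆-sym u v with u ≟ v | v ≟ u
... | yes _   | yes _   = refl
... | no  _   | no  _   = refl
... | yes u≡v | no  v≢u = ⊥-elim (v≢u (sym u≡v))
... | no  u≢v | yes v≡u = ⊥-elim (u≢v (sym v≡u))

∈⁅⁆∪ : ∀ v (W : VSet n) {u} → T ((⁅ v ⁆ ∪ W) u) → u ≡ v ⊎ T (W u)
∈⁅⁆∪ v W u∈ with Equivalence.to T-∨ u∈
... | inj₁ u∈⁅v⁆ = inj₁ (∈⁅⁆⇒≡ u∈⁅v⁆)
... | inj₂ u∈W   = inj₂ u∈W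

∩-monoˡ-⊆ : ∀ {V W X : VSet n} → V ⊆ W → V ∩ X ⊆ W ∩ X
∩-monoˡ-⊆ V⊆W u∈ = Equivalence.from T-∧ (V⊆W (∧-fst u∈) , ∧-snd u∈)

∪-monoʳ-⊆ : ∀ {U V W : VSet n} → V ⊆ W → U ∪ V ⊆ U ∪ W
∪-monoʳ-⊆ {U = U} V⊆W {u} u∈ with U u
... | true  = _
... | false = V⊆W u∈

∉∖ : ∀ (W X : VSet n) {v} → T (X v) → ¬ T ((W ∖ X) v)
∉∖ W X v∈X v∈W∖X = T-not⇒¬T (∧-snd v∈W∖X) v∈X

⁅⁆∪∖⊆ : ∀ (W X : VSet n) {v} → T (W v) → ⁅ v ⁆ ∪ (W ∖ X) ⊆ W
⁅⁆∪∖⊆ W X {v} v∈W u∈ with ∈⁅⁆∪ v (W ∖ X) u∈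
... | inj₁ refl   = v∈W
... | inj₂ u∈W∖X = ∧-fst u∈W∖X

⊆⁅⁆∪∖⁅⁆ : ∀ (W : VSet n) v → W ⊆ ⁅ v ⁆ ∪ (W ∖ ⁅ v ⁆)
⊆⁅⁆∪∖⁅⁆ W v {u} u∈W with W u | ⁅ v ⁆ u
... | true | true  = _
... | true | false = _

private
  𝟙-guard : ∀ b {x y} → (T b → x ≡ y) → 𝟙 b * x ≡ 𝟙 b * y
  𝟙-guard true  x≡y = cong (_+ 0) (x≡y _)
  𝟙-guard false x≡y = refl

  𝟙-guard-≤ : ∀ b {x y} → (T b → x ≤ y) → 𝟙 b * x ≤ 𝟙 b * y
  𝟙-guard-≤ true  x≤y = +-monoˡ-≤ 0 (x≤y _)
  𝟙-guard-≤ false x≤y = z≤n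

∑∈-cong : ∀ (W : VSet n) {f g : Fin n → ℕ} → (∀ {u} → T (W u) → f u ≡ g u) → ∑∈ W f ≡ ∑∈ W g
∑∈-cong W f≡g = sum-cong-≗ (λ u → 𝟙-guard (W u) f≡g)

∑∈-mono-≤ : ∀ (W : VSet n) {f g : Fin n → ℕ} → (∀ {u} → T (W u) → f u ≤ g u) → ∑∈ W f ≤ ∑∈ W g
∑∈-mono-≤ W f≤g = sum-mono-≤ (λ u → 𝟙-guard-≤ (W u) f≤g)

∑∈-distrib-+ : ∀ (W : VSet n) (f g : Fin n → ℕ) → ∑[ u ∈ W ] (f u + g u) ≡ ∑∈ W f + ∑∈ W g
∑∈-distrib-+ W f g = trans (sum-cong-≗ (λ u → *-distribˡ-+ (𝟙 (W u)) (f u) (g u)))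
                           (∑-distrib-+ (λ u → 𝟙 (W u) * f u) (λ u → 𝟙 (W u) * g u))

∑∈-const : ∀ (W : VSet n) (c : ℕ) → ∑[ u ∈ W ] c ≡ size W * c
∑∈-const W c = begin
  ∑[ u ∈ W ] c                 ≡⟨ sum-cong-≗ (λ u → cong (𝟙 (W u) *_) (*-identityˡ c)) ⟨
  ∑[ u ∈ W ] (1 * c)           ≡⟨ sum-cong-≗ (λ u → *-assoc (𝟙 (W u)) 1 c) ⟨
  sum (λ u → 𝟙 (W u) * 1 * c)  ≡⟨ *-distribʳ-sum c (λ u → 𝟙 (W u) * 1) ⟨
  size W * c                   ∎
  where open ≡-Reasoning

∑∈-comm : ∀ (V W : VSet n) (g : Fin n → Fin n → ℕ) →
          ∑[ v ∈ V ] ∑[ u ∈ W ] g u v ≡ ∑[ u ∈ W ] ∑[ v ∈ V ] g u v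
∑∈-comm V W g = begin
  ∑[ v ∈ V ] ∑[ u ∈ W ] g u v
    ≡⟨ sum-cong-≗ (λ v → *-distribˡ-sum (𝟙 (V v)) (λ u → 𝟙 (W u) * g u v)) ⟩
  sum (λ v → sum (λ u → 𝟙 (V v) * (𝟙 (W u) * g u v)))
    ≡⟨ ∑-comm (λ v u → 𝟙 (V v) * (𝟙 (W u) * g u v)) ⟩
  sum (λ u → sum (λ v → 𝟙 (V v) * (𝟙 (W u) * g u v)))
    ≡⟨ sum-cong-≗ (λ u → sum-cong-≗ (λ v → x∙yz≈y∙xz (𝟙 (V v)) (𝟙 (W u)) (g u v))) ⟩
  sum (λ u → sum (λ v → 𝟙 (W u) * (𝟙 (V v) * g u v)))
    ≡⟨ sum-cong-≗ (λ u → *-distribˡ-sum (𝟙 (W u)) (λ v → 𝟙 (V v) * g u v)) ⟨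
  ∑[ u ∈ W ] ∑[ v ∈ V ] g u v
    ∎
  where open ≡-Reasoning

∑∈-∩ : ∀ (V W : VSet n) (f : Fin n → ℕ) → ∑∈ (V ∩ W) f ≡ ∑[ u ∈ V ] (𝟙 (W u) * f u)
∑∈-∩ V W f = sum-cong-≗ (λ u → pointwise (V u) (W u) (f u))
  where
  pointwise : ∀ a b x → 𝟙 (a ∧ b) * x ≡ 𝟙 a * (𝟙 b * x)
  pointwise true  b x = sym (*-identityˡ _)
  pointwise false b x = refl

∑∈-⊆ : ∀ (V W : VSet n) (f : Fin n → ℕ) → V ⊆ W → ∑∈ V f ≤ ∑∈ W f
∑∈-⊆ V W f V⊆W = sum-mono-≤ (λ u → pointwise (V u) (W u) (f u) V⊆W)
  where
  pointwise : ∀ a b x → (T a → T b) → 𝟙 a * x ≤ 𝟙 b * x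
  pointwise true  true  x a⇒b = ≤-refl
  pointwise true  false x a⇒b = ⊥-elim (a⇒b _)
  pointwise false b     x a⇒b = z≤n

∑∈-∪ : ∀ (V W : VSet n) (f : Fin n → ℕ) → ∑∈ (V ∪ W) f ≤ ∑∈ V f + ∑∈ W f
∑∈-∪ V W f = ≤-trans (sum-mono-≤ (λ u → pointwise (V u) (W u) (f u)))
                     (≤-reflexive (∑-distrib-+ (λ u → 𝟙 (V u) * f u) (λ u → 𝟙 (W u) * f u)))
  where
  pointwise : ∀ a b x → 𝟙 (a ∨ b) * x ≤ 𝟙 a * x + 𝟙 b * x
  pointwise true  b x = m≤m+n _ _
  pointwise false b x = ≤-refl

∑∈-∪-disjoint : ∀ (V W : VSet n) (f : Fin n → ℕ) → Disjoint V W → ∑∈ (V ∪ W) f ≡ ∑∈ V f + ∑∈ W f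
∑∈-∪-disjoint V W f V#W = trans (sum-cong-≗ (λ u → pointwise (V u) (W u) (f u) V#W))
                                (∑-distrib-+ (λ u → 𝟙 (V u) * f u) (λ u → 𝟙 (W u) * f u))
  where
  pointwise : ∀ a b x → (T a → T b → ⊥) → 𝟙 (a ∨ b) * x ≡ 𝟙 a * x + 𝟙 b * x
  pointwise true  true  x a#b = ⊥-elim (a#b _ _)
  pointwise true  false x a#b = sym (+-identityʳ _)
  pointwise false b     x a#b = refl

∑∈-split : ∀ (W P : VSet n) (f : Fin n → ℕ) → ∑∈ W f ≡ ∑∈ (W ∩ P) f + ∑∈ (W ∖ P) f
∑∈-split W P f = trans (sum-cong-≗ (λ u → pointwise (W u) (P u) (f u)))
                       (∑-distrib-+ (λ u → 𝟙 (W u ∧ P u) * f u) (λ u → 𝟙 (W u ∧ not (P u)) * f u))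
  where
  pointwise : ∀ a b x → 𝟙 a * x ≡ 𝟙 (a ∧ b) * x + 𝟙 (a ∧ not b) * x
  pointwise true  true  x = sym (+-identityʳ _)
  pointwise true  false x = refl
  pointwise false b     x = refl

∑∈-empty : ∀ (W : VSet n) (f : Fin n → ℕ) → (∀ u → ¬ T (W u)) → ∑∈ W f ≡ 0
∑∈-empty {n} W f W-empty = trans (sum-cong-≗ (λ u → pointwise (W u) (f u) (W-empty u))) (sum-replicate-zero n)
  where
  pointwise : ∀ b x → ¬ T b → 𝟙 b * x ≡ 0
  pointwise true  x b∉ = ⊥-elim (b∉ _)
  pointwise false x b∉ = refl

∑∈-⁅⁆ : ∀ (v : Fin n) (f : Fin n → ℕ) → ∑∈ ⁅ v ⁆ f ≡ f v
∑∈-⁅⁆ {suc n} zero    f = trans (cong₂ _+_ (+-identityʳ (f zero)) (sum-replicate-zero n)) (+-identityʳ (f zero))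
∑∈-⁅⁆ {suc n} (suc v) f = ∑∈-⁅⁆ v (f ∘ suc)

size-⁅⁆ : (v : Fin n) → size ⁅ v ⁆ ≡ 1
size-⁅⁆ v = ∑∈-⁅⁆ v (λ _ → 1)

size-nonempty : ∀ (W : VSet n) {v} → T (W v) → 1 ≤ size W
size-nonempty W {v} v∈W = subst (_≤ size W) (size-⁅⁆ v)
  (∑∈-⊆ ⁅ v ⁆ W _ (λ u∈⁅v⁆ → subst (T ∘ W) (sym (∈⁅⁆⇒≡ u∈⁅v⁆)) v∈W))

size-insert : ∀ (W : VSet n) {v} → ¬ T (W v) → size (⁅ v ⁆ ∪ W) ≡ suc (size W)
size-insert W {v} v∉W =
  trans (∑∈-∪-disjoint ⁅ v ⁆ W _ (λ u∈⁅v⁆ u∈W → v∉W (subst (T ∘ W) (∈⁅⁆⇒≡ u∈⁅v⁆) u∈W)))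
        (cong (_+ size W) (size-⁅⁆ v))

size-∖ : ∀ (W X : VSet n) {v} → T (W v) → T (X v) → suc (size (W ∖ X)) ≤ size W
size-∖ W X {v} v∈W v∈X = begin
  suc (size (W ∖ X))       ≡⟨ size-insert (W ∖ X) (∉∖ W X v∈X) ⟨
  size (⁅ v ⁆ ∪ (W ∖ X))   ≤⟨ ∑∈-⊆ (⁅ v ⁆ ∪ (W ∖ X)) W _ (⁅⁆∪∖⊆ W X v∈W) ⟩
  size W                   ∎
  where open ≤-Reasoning

∑∈-≤⇒∃-≤ : ∀ (W : VSet n) {f g : Fin n → ℕ} {v} → T (W v) → ∑∈ W f ≤ ∑∈ W g →
           ∃ λ u → T (W u) × f u ≤ g u
∑∈-≤⇒∃-≤ W {f} {g} v∈W ∑f≤∑g with any? (λ u → T? (W u) ×-dec (f u ≤? g u))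
... | yes found = found
... | no  none  = ⊥-elim (<⇒≱ ∑g<∑f ∑f≤∑g)
  where
  g<f : ∀ {u} → T (W u) → g u + 1 ≤ f u
  g<f {u} u∈W = subst (_≤ f u) (+-comm 1 (g u)) (≰⇒> (λ fu≤gu → none (u , u∈W , fu≤gu)))
  ∑g<∑f : ∑∈ W g < ∑∈ W f
  ∑g<∑f = begin-strict
    ∑∈ W g                 <⟨ m<m+n (∑∈ W g) (size-nonempty W v∈W) ⟩
    ∑∈ W g + size W        ≡⟨ ∑∈-distrib-+ W g (λ _ → 1) ⟨
    ∑[ u ∈ W ] (g u + 1)   ≤⟨ ∑∈-mono-≤ W g<f ⟩
    ∑∈ W f                 ∎
    where open ≤-Reasoning

∑∈-swap : ∀ {R : Fin n → VSet n} → Symmetric R → ∀ (V W : VSet n) (h : Fin n → Fin n → ℕ) →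
          ∑[ v ∈ V ] ∑[ u ∈ W ∩ R v ] h u v ≡ ∑[ u ∈ W ] ∑[ v ∈ V ∩ R u ] h u v
∑∈-swap {R = R} R-sym V W h = begin
  ∑[ v ∈ V ] ∑[ u ∈ W ∩ R v ] h u v          ≡⟨ ∑∈-cong V (λ {v} _ → ∑∈-∩ W (R v) (λ u → h u v)) ⟩
  ∑[ v ∈ V ] ∑[ u ∈ W ] (𝟙 (R v u) * h u v)  ≡⟨ ∑∈-comm V W (λ u v → 𝟙 (R v u) * h u v) ⟩
  ∑[ u ∈ W ] ∑[ v ∈ V ] (𝟙 (R v u) * h u v)  ≡⟨ ∑∈-cong W (λ {u} _ → ∑∈-cong V (λ {v} _ →
                                                  cong (λ b → 𝟙 b * h u v) (R-sym v u))) ⟩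
  ∑[ u ∈ W ] ∑[ v ∈ V ] (𝟙 (R u v) * h u v)  ≡⟨ ∑∈-cong W (λ {u} _ → ∑∈-∩ V (R u) (h u)) ⟨
  ∑[ u ∈ W ] ∑[ v ∈ V ∩ R u ] h u v          ∎
  where open ≡-Reasoning

rearrangement-≤ : ∀ {a a′ b b′} → a ≤ a′ → b′ ≤ b → a * b + a′ * b′ ≤ a′ * b + a * b′
rearrangement-≤ {a} {a′} {b} {b′} a≤a′ b′≤b = begin
  a * b + a′ * b′                        ≤⟨ m≤m+n _ (s * t) ⟩
  a * b + a′ * b′ + s * t                ≡⟨ cong₂ (λ x y → a * y + x * b′ + s * t) a+s≡a′ b′+t≡b ⟨
  a * (b′ + t) + (a + s) * b′ + s * t    ≡⟨ expand a s b′ t ⟩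
  (a + s) * (b′ + t) + a * b′            ≡⟨ cong₂ (λ x y → x * y + a * b′) a+s≡a′ b′+t≡b ⟩
  a′ * b + a * b′                        ∎
  where
  open ≤-Reasoning
  s = a′ ∸ a
  t = b ∸ b′
  a+s≡a′ = m+[n∸m]≡n a≤a′
  b′+t≡b = m+[n∸m]≡n b′≤b
  expand : ∀ a s b′ t → a * (b′ + t) + (a + s) * b′ + s * t ≡ (a + s) * (b′ + t) + a * b′
  expand = solve-∀

-- Summing the hypothesis over ordered pairs counts every pair twice, once in each order.
∑∈-rearrangement : ∀ {R : Fin n → VSet n} → Symmetric R → ∀ W (a b : Fin n → ℕ) →
  (∀ {u w} → T (W u) → T (W w) → T (R u w) → a u * b u + a w * b w ≤ a w * b u + a u * b w) →
  ∑[ u ∈ W ] ∑[ w ∈ W ∩ R u ] (a u * b u) ≤ ∑[ u ∈ W ] ∑[ w ∈ W ∩ R u ] (a w * b u)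
∑∈-rearrangement {n} {R} R-sym W a b pair-≤ = *-cancelˡ-≤ 2 (begin
  2 * S same                           ≡⟨ twice (S same) ⟩
  S same + S same                      ≡⟨ cong (S same +_) (flip same) ⟨
  S same + S (λ u w → same w u)        ≡⟨ distrib same (λ u w → same w u) ⟨
  S (λ u w → same u w + same w u)      ≤⟨ ∑∈-mono-≤ W (λ u∈W → ∑∈-mono-≤ (W ∩ R _) (λ w∈ →
                                            pair-≤ u∈W (∧-fst w∈) (∧-snd w∈))) ⟩
  S (λ u w → cross u w + cross w u)    ≡⟨ distrib cross (λ u w → cross w u) ⟩
  S cross + S (λ u w → cross w u)      ≡⟨ cong (S cross +_) (flip cross) ⟩
  S cross + S cross                    ≡⟨ twice (S cross) ⟨
  2 * S cross                          ∎)
  where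
  open ≤-Reasoning
  same cross : Fin n → Fin n → ℕ
  same  u w = a u * b u
  cross u w = a w * b u
  S : (Fin n → Fin n → ℕ) → ℕ
  S h = ∑[ u ∈ W ] ∑[ w ∈ W ∩ R u ] h u w
  twice : ∀ x → 2 * x ≡ x + x
  twice x = cong (x +_) (+-identityʳ x)
  flip : ∀ h → S (λ u w → h w u) ≡ S h
  flip h = ∑∈-swap R-sym W W h
  distrib : ∀ g h → S (λ u w → g u w + h u w) ≡ S g + S h
  distrib g h = trans (∑∈-cong W (λ {u} _ → ∑∈-distrib-+ (W ∩ R u) (g u) (h u)))
                      (∑∈-distrib-+ W (λ u → ∑[ w ∈ W ∩ R u ] g u w) (λ u → ∑[ w ∈ W ∩ R u ] h u w))

∈⇒T : ∀ {p : Subset n} {x} → x Subset.∈ p → T (lookup p x)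
∈⇒T x∈p = subst T (sym ([]=⇒lookup x∈p)) _

T⇒∈ : ∀ {p : Subset n} {x} → T (lookup p x) → x Subset.∈ p
T⇒∈ {p = p} {x} t = lookup⇒[]= x p (Equivalence.to T-≡ t)

∈tabulate⇒T : ∀ (W : VSet n) {x} → x Subset.∈ tabulate W → T (W x)
∈tabulate⇒T W {x} x∈ = subst T (lookup∘tabulate W x) (∈⇒T x∈)

T⇒∈tabulate : ∀ (W : VSet n) {x} → T (W x) → x Subset.∈ tabulate W
T⇒∈tabulate W {x} x∈W = T⇒∈ (subst T (sym (lookup∘tabulate W x)) x∈W)

size-lookup : ∀ (p : Subset n) → ∣ p ∣ ≡ size (lookup p)
size-lookup []          = refl
size-lookup (true ∷ p)  = cong suc (size-lookup p)
size-lookup (false ∷ p) = size-lookup p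

size-tabulate : ∀ (W : VSet n) → ∣ tabulate W ∣ ≡ size W
size-tabulate W =
  trans (size-lookup (tabulate W)) (sum-cong-≗ (λ u → cong (λ b → 𝟙 b * 1) (lookup∘tabulate W u)))

-- Neighbourhoods and degrees inside a vertex set

module GraphNotation (G : SimpleGraph n) where

  N : Fin n → VSet n
  N = adj G

  N[_] : Fin n → VSet n
  N[ u ] = ⁅ u ⁆ ∪ N u

  deg : VSet n → Fin n → ℕ
  deg W u = size (W ∩ N u)

  codeg : VSet n → Fin n → Fin n → ℕ
  codeg W u v = deg (W ∩ N u) v

  MaxDegree≤ : ℕ → VSet n → Set
  MaxDegree≤ D W = ∀ {u} → T (W u) → deg W u ≤ D

  IsIndependent : VSet n → Set
  IsIndependent I = ∀ {u w} → T (I u) → T (I w) → adj G u w ≡ false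

  N-sym : Symmetric N
  N-sym = SimpleGraph.sym G

  N[]-sym : Symmetric N[_]
  N[]-sym u v = cong₂ _∨_ (⁅⁆-sym v u) (SimpleGraph.sym G u v)

  ∁N[]-sym : Symmetric (λ v → ∁ N[ v ])
  ∁N[]-sym u v = cong not (N[]-sym u v)

  v∈N[v] : ∀ v → T (N[ v ] v)
  v∈N[v] v = Equivalence.from T-∨ (inj₁ (v∈⁅v⁆ v))

  deg-mono : ∀ V W u → V ⊆ W → deg V u ≤ deg W u
  deg-mono V W u V⊆W = ∑∈-⊆ (V ∩ N u) (W ∩ N u) _ (∩-monoˡ-⊆ {V = V} {W} {N u} V⊆W)

  deg-∪ : ∀ V W u → deg (V ∪ W) u ≤ deg V u + deg W u
  deg-∪ V W u = ≤-trans (∑∈-⊆ ((V ∪ W) ∩ N u) (V ∩ N u ∪ W ∩ N u) _ (λ {w} → distrib (V w) (W w) (N u w)))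
                        (∑∈-∪ (V ∩ N u) (W ∩ N u) _)
    where
    distrib : ∀ a b c → T ((a ∨ b) ∧ c) → T (a ∧ c ∨ b ∧ c)
    distrib true  b     true  _ = _
    distrib false true  true  _ = _
    distrib true  b     false ()
    distrib false true  false ()
    distrib false false c     ()

  ∑-deg-comm : ∀ V W → ∑[ u ∈ V ] deg W u ≡ ∑[ w ∈ W ] deg V w
  ∑-deg-comm V W = ∑∈-swap N-sym V W (λ _ _ → 1)

  deg-pos : ∀ W {u w} → T (W w) → T (adj G u w) → 1 ≤ deg W u
  deg-pos W {u} w∈W u~w = size-nonempty (W ∩ N u) (Equivalence.from T-∧ (w∈W , u~w))

-- Shearer's potential argument

-- What the potential argument needs of K · f, for Shearer's function f; ∂F k = F (k − 1) − F k.
record ShearerWeights (D K : ℕ) : Set where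
  field
    F ∂F       : ℕ → ℕ
    F-step     : ∀ {k} → suc k ≤ D → F k ≡ F (suc k) + ∂F (suc k)
    ∂F-step    : ∀ {k} → 1 ≤ k → suc k ≤ D → ∂F (suc k) ≤ ∂F k
    recurrence : ∀ {k} → k ≤ D → suc k * F k ≤ K + k * (k ∸ 1) * ∂F k

  ∂F-antitone : ∀ {x y} → 1 ≤ x → x ≤′ y → y ≤ D → ∂F y ≤ ∂F x
  ∂F-antitone 1≤x ≤′-refl               y≤D   = ≤-refl
  ∂F-antitone 1≤x (≤′-step {y} x≤′y) 1+y≤D =
    ≤-trans (∂F-step (≤-trans 1≤x (≤′⇒≤ x≤′y)) 1+y≤D) (∂F-antitone 1≤x x≤′y (<⇒≤ 1+y≤D))

  F-drop-+ : ∀ x t → x + t ≤ D → F (x + t) + t * ∂F (x + t) ≤ F x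
  F-drop-+ x zero    _ rewrite +-identityʳ x = ≤-reflexive (+-identityʳ (F x))
  F-drop-+ x (suc t) x+1+t≤D rewrite +-suc x t = begin
    F (suc x + t) + suc t * ∂F (suc x + t)
      ≡⟨ rearrange (F (suc x + t)) t (∂F (suc x + t)) ⟩
    (F (suc x + t) + t * ∂F (suc x + t)) + ∂F (suc x + t)
      ≤⟨ +-mono-≤ (F-drop-+ (suc x) t x+1+t≤D) (∂F-antitone (s≤s z≤n) (≤⇒≤′ (m≤m+n (suc x) t)) x+1+t≤D) ⟩
    F (suc x) + ∂F (suc x)
      ≡⟨ F-step (≤-trans (m≤m+n (suc x) t) x+1+t≤D) ⟨
    F x
      ∎
    where
    open ≤-Reasoning
    rearrange : ∀ f t d → f + suc t * d ≡ (f + t * d) + d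
    rearrange = solve-∀

  F-drop : ∀ {x y} c → x + c ≤ y → y ≤ D → F y + c * ∂F y ≤ F x
  F-drop {x} {y} c x+c≤y y≤D = begin
    F y + c * ∂F y              ≤⟨ +-monoʳ-≤ (F y) (*-monoˡ-≤ (∂F y) c≤t) ⟩
    F y + t * ∂F y              ≡⟨ cong (λ z → F z + t * ∂F z) (m+[n∸m]≡n x≤y) ⟨
    F (x + t) + t * ∂F (x + t)  ≤⟨ F-drop-+ x t (subst (_≤ D) (sym (m+[n∸m]≡n x≤y)) y≤D) ⟩
    F x                         ∎
    where
    open ≤-Reasoning
    t = y ∸ x
    x≤y : x ≤ y
    x≤y = m+n≤o⇒m≤o x x+c≤y
    c≤t : c ≤ t
    c≤t = subst (_≤ t) (m+n∸m≡n x c) (∸-monoˡ-≤ x x+c≤y)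

  F-antitone : ∀ {x y} → x ≤ y → y ≤ D → F y ≤ F x
  F-antitone {x} {y} x≤y y≤D =
    ≤-trans (m≤m+n (F y) 0) (F-drop 0 (subst (_≤ y) (sym (+-identityʳ x)) x≤y) y≤D)

module Shearer (G : SimpleGraph n) (△-free : TriangleFree G) {D K : ℕ} (weights : ShearerWeights D K) where

  open GraphNotation G
  open ShearerWeights weights

  Φ : VSet n → ℕ
  Φ W = ∑[ u ∈ W ] F (deg W u)

  -- Removing N[ v ] takes codeg W u v neighbours from each u ∉ N[ v ], raising the F-values by at least gain W v.
  gain : VSet n → Fin n → ℕ
  gain W v = ∑[ u ∈ W ∖ N[ v ] ] (codeg W u v * ∂F (deg W u))

  deg-∖N[]+codeg≤deg : ∀ W u v → deg (W ∖ N[ v ]) u + codeg W u v ≤ deg W u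
  deg-∖N[]+codeg≤deg W u v = begin
    deg (W ∖ N[ v ]) u + codeg W u v  ≡⟨ ∑∈-∪-disjoint A B (λ _ → 1) A#B ⟨
    size (A ∪ B)                      ≤⟨ ∑∈-⊆ (A ∪ B) (W ∩ N u) (λ _ → 1) A∪B⊆ ⟩
    deg W u                           ∎
    where
    open ≤-Reasoning
    A = (W ∖ N[ v ]) ∩ N u
    B = (W ∩ N u) ∩ N v
    A#B : Disjoint A B
    A#B {w} = pointwise (W w) (⁅ v ⁆ w) (N v w) (N u w)
      where
      pointwise : ∀ a b c d → T ((a ∧ not (b ∨ c)) ∧ d) → T ((a ∧ d) ∧ c) → ⊥
      pointwise true  false false true  _  ()
      pointwise true  false false false () _
      pointwise true  false true  d     () _
      pointwise true  true  c     d     () _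
      pointwise false b     c     d     () _
    A∪B⊆ : A ∪ B ⊆ W ∩ N u
    A∪B⊆ {w} = pointwise (W w) (⁅ v ⁆ w) (N v w) (N u w)
      where
      pointwise : ∀ a b c d → T ((a ∧ not (b ∨ c)) ∧ d ∨ (a ∧ d) ∧ c) → T (a ∧ d)
      pointwise true  b     c     true  _  = _
      pointwise true  true  c     false ()
      pointwise true  false true  false ()
      pointwise true  false false false ()
      pointwise false b     c     d     ()

  Φ-∖N[] : ∀ W v → MaxDegree≤ D W →
           Φ W + gain W v ≤ Φ (W ∖ N[ v ]) + ∑[ u ∈ W ∩ N[ v ] ] F (deg W u)
  Φ-∖N[] W v Δ = begin
    Φ W + gain W v
      ≡⟨ cong (_+ gain W v) (∑∈-split W N[ v ] (F ∘ deg W)) ⟩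
    (A + ∑[ u ∈ W ∖ N[ v ] ] F (deg W u)) + gain W v
      ≡⟨ +-assoc A _ (gain W v) ⟩
    A + (∑[ u ∈ W ∖ N[ v ] ] F (deg W u) + gain W v)
      ≡⟨ cong (A +_) (∑∈-distrib-+ (W ∖ N[ v ]) (F ∘ deg W) (λ u → codeg W u v * ∂F (deg W u))) ⟨
    A + ∑[ u ∈ W ∖ N[ v ] ] (F (deg W u) + codeg W u v * ∂F (deg W u))
      ≤⟨ +-monoʳ-≤ A (∑∈-mono-≤ (W ∖ N[ v ])
           (λ {u} u∈ → F-drop (codeg W u v) (deg-∖N[]+codeg≤deg W u v) (Δ (∧-fst u∈)))) ⟩
    A + Φ (W ∖ N[ v ])
      ≡⟨ +-comm A _ ⟩
    Φ (W ∖ N[ v ]) + A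
      ∎
    where
    open ≤-Reasoning
    A = ∑[ u ∈ W ∩ N[ v ] ] F (deg W u)

  size-∩N[] : ∀ W u → size (W ∩ N[ u ]) ≤ suc (deg W u)
  size-∩N[] W u = begin
    size (W ∩ N[ u ])          ≤⟨ ∑∈-⊆ (W ∩ N[ u ]) (⁅ u ⁆ ∪ W ∩ N u) _ covered ⟩
    size (⁅ u ⁆ ∪ W ∩ N u)     ≤⟨ ∑∈-∪ ⁅ u ⁆ (W ∩ N u) _ ⟩
    size ⁅ u ⁆ + deg W u       ≡⟨ cong (_+ deg W u) (size-⁅⁆ u) ⟩
    suc (deg W u)              ∎
    where
    open ≤-Reasoning
    covered : W ∩ N[ u ] ⊆ ⁅ u ⁆ ∪ W ∩ N u
    covered {w} = pointwise (W w) (⁅ u ⁆ w) (N u w)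
      where
      pointwise : ∀ a b c → T (a ∧ (b ∨ c)) → T (b ∨ a ∧ c)
      pointwise true  true  c _  = _
      pointwise true  false c c∈ = c∈
      pointwise false b     c ()

  -- In a triangle-free graph the neighbours of a neighbour w of u, other than u, are not adjacent to u.
  deg∸1≤deg-∖N[] : ∀ W {u w} → T (adj G u w) → deg W w ∸ 1 ≤ deg (W ∖ N[ u ]) w
  deg∸1≤deg-∖N[] W {u} {w} u~w = m≤n+o⇒m∸n≤o (deg W w) 1 (begin
    deg W w                                ≤⟨ ∑∈-⊆ (W ∩ N w) (⁅ u ⁆ ∪ (W ∖ N[ u ]) ∩ N w) _ covered ⟩
    size (⁅ u ⁆ ∪ (W ∖ N[ u ]) ∩ N w)      ≤⟨ ∑∈-∪ ⁅ u ⁆ ((W ∖ N[ u ]) ∩ N w) _ ⟩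
    size ⁅ u ⁆ + deg (W ∖ N[ u ]) w        ≡⟨ cong (_+ deg (W ∖ N[ u ]) w) (size-⁅⁆ u) ⟩
    1 + deg (W ∖ N[ u ]) w                 ∎)
    where
    open ≤-Reasoning
    covered : (W ∩ N w) ⊆ (⁅ u ⁆ ∪ (W ∖ N[ u ]) ∩ N w)
    covered {x} x∈ with ⁅ u ⁆ x | adj G u x in u~x | W x
    ... | true  | _     | _     = _
    ... | false | false | true  = ∧-snd x∈
    ... | false | false | false = x∈
    ... | false | true  | _     = ⊥-elim (△-free (u , w , x , u~w , ∧-snd x∈ , subst T (sym u~x) _))

  degree-rearrangement : ∀ W → MaxDegree≤ D W → ∀ {u w} → T (W u) → T (W w) → T (adj G u w) →
    (deg W u ∸ 1) * ∂F (deg W u) + (deg W w ∸ 1) * ∂F (deg W w)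
      ≤ (deg W w ∸ 1) * ∂F (deg W u) + (deg W u ∸ 1) * ∂F (deg W w)
  degree-rearrangement W Δ {u} {w} u∈W w∈W u~w with ≤-total (deg W u) (deg W w)
  ... | inj₁ du≤dw =
    rearrangement-≤ (∸-monoˡ-≤ 1 du≤dw) (∂F-antitone (deg-pos W w∈W u~w) (≤⇒≤′ du≤dw) (Δ w∈W))
  ... | inj₂ dw≤du = subst₂ _≤_ (+-comm (a w * b w) (a u * b u)) (+-comm (a u * b w) (a w * b u))
    (rearrangement-≤ (∸-monoˡ-≤ 1 dw≤du) (∂F-antitone (deg-pos W u∈W w~u) (≤⇒≤′ dw≤du) (Δ u∈W)))
    where
    w~u = subst T (SimpleGraph.sym G u w) u~w
    a b : Fin n → ℕ
    a x = deg W x ∸ 1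
    b x = ∂F (deg W x)

  ∑-deg²≤∑-gain : ∀ W → MaxDegree≤ D W →
    ∑[ u ∈ W ] (deg W u * (deg W u ∸ 1) * ∂F (deg W u)) ≤ ∑[ v ∈ W ] gain W v
  ∑-deg²≤∑-gain W Δ = begin
    ∑[ u ∈ W ] (deg W u * (deg W u ∸ 1) * ∂F (deg W u))
      ≡⟨ ∑∈-cong W (λ {u} _ → trans (*-assoc (deg W u) _ _) (sym (∑∈-const (W ∩ N u) _))) ⟩
    ∑[ u ∈ W ] ∑[ w ∈ W ∩ N u ] ((deg W u ∸ 1) * ∂F (deg W u))
      ≤⟨ ∑∈-rearrangement N-sym W (λ u → deg W u ∸ 1) (∂F ∘ deg W) (degree-rearrangement W Δ) ⟩
    ∑[ u ∈ W ] ∑[ w ∈ W ∩ N u ] ((deg W w ∸ 1) * ∂F (deg W u))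
      ≤⟨ ∑∈-mono-≤ W (λ {u} _ → ∑∈-mono-≤ (W ∩ N u) (λ w∈ →
           *-monoˡ-≤ (∂F (deg W u)) (deg∸1≤deg-∖N[] W (∧-snd w∈)))) ⟩
    ∑[ u ∈ W ] ∑[ w ∈ W ∩ N u ] (deg (W ∖ N[ u ]) w * ∂F (deg W u))
      ≡⟨ ∑∈-cong W (λ {u} _ → codeg-double-count u) ⟩
    ∑[ u ∈ W ] ∑[ v ∈ W ∖ N[ u ] ] (codeg W u v * ∂F (deg W u))
      ≡⟨ ∑∈-swap ∁N[]-sym W W (λ u v → codeg W u v * ∂F (deg W u)) ⟨
    ∑[ v ∈ W ] gain W v
      ∎
    where
    open ≤-Reasoning
    codeg-double-count : ∀ u →
      ∑[ w ∈ W ∩ N u ] (deg (W ∖ N[ u ]) w * ∂F (deg W u)) ≡ ∑[ v ∈ W ∖ N[ u ] ] (codeg W u v * ∂F (deg W u))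
    codeg-double-count u = begin-equality
      ∑[ w ∈ W ∩ N u ] (deg (W ∖ N[ u ]) w * c)
        ≡⟨ ∑∈-cong (W ∩ N u) (λ {w} _ → ∑∈-const ((W ∖ N[ u ]) ∩ N w) c) ⟨
      ∑[ w ∈ W ∩ N u ] ∑[ v ∈ (W ∖ N[ u ]) ∩ N w ] c
        ≡⟨ ∑∈-swap N-sym (W ∖ N[ u ]) (W ∩ N u) (λ _ _ → c) ⟨
      ∑[ v ∈ W ∖ N[ u ] ] ∑[ w ∈ (W ∩ N u) ∩ N v ] c
        ≡⟨ ∑∈-cong (W ∖ N[ u ]) (λ {v} _ → ∑∈-const ((W ∩ N u) ∩ N v) c) ⟩
      ∑[ v ∈ W ∖ N[ u ] ] (codeg W u v * c)
        ∎
      where c = ∂F (deg W u)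

  ∑-∩N[]≤ : ∀ W → MaxDegree≤ D W →
    ∑[ v ∈ W ] ∑[ u ∈ W ∩ N[ v ] ] F (deg W u) ≤ size W * K + ∑[ v ∈ W ] gain W v
  ∑-∩N[]≤ W Δ = begin
    ∑[ v ∈ W ] ∑[ u ∈ W ∩ N[ v ] ] F (deg W u)
      ≡⟨ ∑∈-swap N[]-sym W W (λ u _ → F (deg W u)) ⟩
    ∑[ u ∈ W ] ∑[ v ∈ W ∩ N[ u ] ] F (deg W u)
      ≡⟨ ∑∈-cong W (λ {u} _ → ∑∈-const (W ∩ N[ u ]) (F (deg W u))) ⟩
    ∑[ u ∈ W ] (size (W ∩ N[ u ]) * F (deg W u))
      ≤⟨ ∑∈-mono-≤ W (λ {u} _ → *-monoˡ-≤ (F (deg W u)) (size-∩N[] W u)) ⟩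
    ∑[ u ∈ W ] (suc (deg W u) * F (deg W u))
      ≤⟨ ∑∈-mono-≤ W (λ u∈W → recurrence (Δ u∈W)) ⟩
    ∑[ u ∈ W ] (K + deg W u * (deg W u ∸ 1) * ∂F (deg W u))
      ≡⟨ ∑∈-distrib-+ W (λ _ → K) (λ u → deg W u * (deg W u ∸ 1) * ∂F (deg W u)) ⟩
    ∑[ u ∈ W ] K + ∑[ u ∈ W ] (deg W u * (deg W u ∸ 1) * ∂F (deg W u))
      ≤⟨ +-mono-≤ (≤-reflexive (∑∈-const W K)) (∑-deg²≤∑-gain W Δ) ⟩
    size W * K + ∑[ v ∈ W ] gain W v
      ∎
    where open ≤-Reasoning

  Φ-average : ∀ W → MaxDegree≤ D W → ∑[ v ∈ W ] Φ W ≤ ∑[ v ∈ W ] (Φ (W ∖ N[ v ]) + K)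
  Φ-average W Δ = +-cancelʳ-≤ Γ _ _ (begin
    ∑[ v ∈ W ] Φ W + Γ
      ≡⟨ ∑∈-distrib-+ W (λ _ → Φ W) (gain W) ⟨
    ∑[ v ∈ W ] (Φ W + gain W v)
      ≤⟨ ∑∈-mono-≤ W (λ {v} _ → Φ-∖N[] W v Δ) ⟩
    ∑[ v ∈ W ] (Φ (W ∖ N[ v ]) + ∑[ u ∈ W ∩ N[ v ] ] F (deg W u))
      ≡⟨ ∑∈-distrib-+ W (λ v → Φ (W ∖ N[ v ])) (λ v → ∑[ u ∈ W ∩ N[ v ] ] F (deg W u)) ⟩
    ∑[ v ∈ W ] Φ (W ∖ N[ v ]) + ∑[ v ∈ W ] ∑[ u ∈ W ∩ N[ v ] ] F (deg W u)
      ≤⟨ +-monoʳ-≤ _ (∑-∩N[]≤ W Δ) ⟩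
    ∑[ v ∈ W ] Φ (W ∖ N[ v ]) + (size W * K + Γ)
      ≡⟨ +-assoc _ (size W * K) Γ ⟨
    ∑[ v ∈ W ] Φ (W ∖ N[ v ]) + size W * K + Γ
      ≡⟨ cong (λ x → ∑[ v ∈ W ] Φ (W ∖ N[ v ]) + x + Γ) (∑∈-const W K) ⟨
    ∑[ v ∈ W ] Φ (W ∖ N[ v ]) + ∑[ v ∈ W ] K + Γ
      ≡⟨ cong (_+ Γ) (∑∈-distrib-+ W (λ v → Φ (W ∖ N[ v ])) (λ _ → K)) ⟨
    ∑[ v ∈ W ] (Φ (W ∖ N[ v ]) + K) + Γ
      ∎)
    where
    open ≤-Reasoning
    Γ = ∑[ v ∈ W ] gain W v

  ∉∖N[] : ∀ W {u v} → T ((W ∖ N[ v ]) u) → adj G v u ≡ false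
  ∉∖N[] W {u} {v} u∈ with W u | ⁅ v ⁆ u | adj G v u
  ... | true  | false | false = refl
  ... | true  | false | true  = ⊥-elim u∈
  ... | true  | true  | _     = ⊥-elim u∈
  ... | false | _     | _     = ⊥-elim u∈

  insert-independent : ∀ {W v I} → I ⊆ W ∖ N[ v ] → IsIndependent I → IsIndependent (⁅ v ⁆ ∪ I)
  insert-independent {W} {v} {I} I⊆ I-indep {x} {y} x∈ y∈ with ∈⁅⁆∪ v I x∈ | ∈⁅⁆∪ v I y∈
  ... | inj₁ refl | inj₁ refl = SimpleGraph.irrefl G v
  ... | inj₁ refl | inj₂ y∈I  = ∉∖N[] W (I⊆ y∈I)
  ... | inj₂ x∈I  | inj₁ refl = trans (SimpleGraph.sym G x v) (∉∖N[] W (I⊆ x∈I))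
  ... | inj₂ x∈I  | inj₂ y∈I  = I-indep x∈I y∈I

  Φ≤Kα : VSet n → Set
  Φ≤Kα W = ∃ λ I → I ⊆ W × IsIndependent I × Φ W ≤ K * size I

  shearer-bounded : ∀ s W → size W ≤ s → MaxDegree≤ D W → Φ≤Kα W
  shearer-bounded s W |W|≤s Δ with any? (T? ∘ W)
  ... | no W-empty = (λ _ → false) , (λ ()) , (λ ()) , ≤-trans (≤-reflexive Φ≡0) z≤n
    where
    Φ≡0 : Φ W ≡ 0
    Φ≡0 = ∑∈-empty W _ (λ u u∈W → W-empty (u , u∈W))
  shearer-bounded zero    W |W|≤0   Δ | yes (v₀ , v₀∈W) = ⊥-elim (<⇒≱ (size-nonempty W v₀∈W) |W|≤0)
  shearer-bounded (suc s) W |W|≤1+s Δ | yes (v₀ , v₀∈W)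
    with ∑∈-≤⇒∃-≤ W {f = λ _ → Φ W} {g = λ v → Φ (W ∖ N[ v ]) + K} v₀∈W (Φ-average W Δ)
  ... | v , v∈W , ΦW≤ with shearer-bounded s (W ∖ N[ v ]) |W′|≤s Δ′
    where
    |W′|≤s : size (W ∖ N[ v ]) ≤ s
    |W′|≤s = ≤-pred (≤-trans (size-∖ W N[ v ] v∈W (v∈N[v] v)) |W|≤1+s)
    Δ′ : MaxDegree≤ D (W ∖ N[ v ])
    Δ′ u∈ = ≤-trans (deg-mono (W ∖ N[ v ]) W _ ∧-fst) (Δ (∧-fst u∈))
  ... | I , I⊆ , I-indep , ΦW′≤ =
    ⁅ v ⁆ ∪ I ,
    (λ {u} u∈ → ⁅⁆∪∖⊆ W N[ v ] v∈W (∪-monoʳ-⊆ {U = ⁅ v ⁆} {V = I} {W = W ∖ N[ v ]} I⊆ {u} u∈)) ,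
    insert-independent {W} I⊆ I-indep ,
    (begin
      Φ W                        ≤⟨ ΦW≤ ⟩
      Φ (W ∖ N[ v ]) + K         ≤⟨ +-monoˡ-≤ K ΦW′≤ ⟩
      K * size I + K             ≡⟨ +-comm (K * size I) K ⟩
      K + K * size I             ≡⟨ *-suc K (size I) ⟨
      K * suc (size I)           ≡⟨ cong (K *_) (size-insert I (∉∖ W N[ v ] (v∈N[v] v) ∘ I⊆)) ⟨
      K * size (⁅ v ⁆ ∪ I)       ∎)
    where open ≤-Reasoning

  shearer : ∀ W → MaxDegree≤ D W → Φ≤Kα W
  shearer W = shearer-bounded (size W) W ≤-refl

  size*F[D]≤Φ : ∀ W → MaxDegree≤ D W → size W * F D ≤ Φ W
  size*F[D]≤Φ W Δ = begin
    size W * F D          ≡⟨ ∑∈-const W (F D) ⟨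
    ∑[ u ∈ W ] F D        ≤⟨ ∑∈-mono-≤ W (λ u∈W → F-antitone (Δ u∈W) ≤-refl) ⟩
    Φ W                   ∎
    where open ≤-Reasoning

-- Shearer's function

-- f(m) = num m / den m, where f(0) = 1 and ((m + 1)² + 1) f(m + 1) = 1 + (m + 1) m f(m).
den : ℕ → ℕ
den zero    = 1
den (suc m) = (suc m * suc m + 1) * den m

num : ℕ → ℕ
num zero    = 1
num (suc m) = den m + suc m * m * num m

num-upper : ∀ m → 2 * suc m * num m ≤ (m + 2) * den m
num-upper zero    = ≤-refl
num-upper (suc m) = begin
  2 * suc (suc m) * (den m + suc m * m * num m)
    ≡⟨ expand m (den m) (num m) ⟩
  2 * (m + 2) * den m + m * (m + 2) * (2 * suc m * num m)
    ≤⟨ +-monoʳ-≤ (2 * (m + 2) * den m) (*-monoʳ-≤ (m * (m + 2)) (num-upper m)) ⟩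
  2 * (m + 2) * den m + m * (m + 2) * ((m + 2) * den m)
    ≤⟨ m≤m+n _ ((m * m + 2 * m + 2) * den m) ⟩
  2 * (m + 2) * den m + m * (m + 2) * ((m + 2) * den m) + (m * m + 2 * m + 2) * den m
    ≡⟨ collect m (den m) ⟩
  (suc m + 2) * ((suc m * suc m + 1) * den m)
    ∎
  where
  open ≤-Reasoning
  expand : ∀ m p q → 2 * suc (suc m) * (p + suc m * m * q) ≡ 2 * (m + 2) * p + m * (m + 2) * (2 * suc m * q)
  expand = solve-∀
  collect : ∀ m p → 2 * (m + 2) * p + m * (m + 2) * ((m + 2) * p) + (m * m + 2 * m + 2) * p
                    ≡ (suc m + 2) * ((suc m * suc m + 1) * p)
  collect = solve-∀

num-lower : ∀ m → 3 * den m ≤ 2 * (m + 2) * num m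
num-lower zero    = s≤s (s≤s (s≤s z≤n))
num-lower (suc m) = *-cancelˡ-≤ (2 + m) (begin
  (2 + m) * (3 * ((suc m * suc m + 1) * den m))
    ≤⟨ m≤m+n _ ((2 * m * m + m) * den m) ⟩
  (2 + m) * (3 * ((suc m * suc m + 1) * den m)) + (2 * m * m + m) * den m
    ≡⟨ split m (den m) ⟩
  2 * (m + 2) * (m + 3) * den m + (m + 3) * (m + 1) * m * (3 * den m)
    ≤⟨ +-monoʳ-≤ (2 * (m + 2) * (m + 3) * den m) (*-monoʳ-≤ ((m + 3) * (m + 1) * m) (num-lower m)) ⟩
  2 * (m + 2) * (m + 3) * den m + (m + 3) * (m + 1) * m * (2 * (m + 2) * num m)
    ≡⟨ collect m (den m) (num m) ⟩
  (2 + m) * (2 * (suc m + 2) * (den m + suc m * m * num m))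
    ∎)
  where
  open ≤-Reasoning
  split : ∀ m p → (2 + m) * (3 * ((suc m * suc m + 1) * p)) + (2 * m * m + m) * p
                  ≡ 2 * (m + 2) * (m + 3) * p + (m + 3) * (m + 1) * m * (3 * p)
  split = solve-∀
  collect : ∀ m p q → 2 * (m + 2) * (m + 3) * p + (m + 3) * (m + 1) * m * (2 * (m + 2) * q)
                      ≡ (2 + m) * (2 * (suc m + 2) * (p + suc m * m * q))
  collect = solve-∀

1≤den : ∀ m → 1 ≤ den m
1≤den zero    = ≤-refl
1≤den (suc m) = *-mono-≤ (m≤n+m 1 (suc m * suc m)) (1≤den m)

den≤ : ∀ m → den m ≤ (m + 2) * num m
den≤ m = *-cancelˡ-≤ 2 (begin
  2 * den m              ≤⟨ *-monoˡ-≤ (den m) (n≤1+n 2) ⟩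
  3 * den m              ≤⟨ num-lower m ⟩
  2 * (m + 2) * num m    ≡⟨ *-assoc 2 (m + 2) (num m) ⟩
  2 * ((m + 2) * num m)  ∎)
  where open ≤-Reasoning

-- gap m = den (m + 1) · (f(m) − f(m + 1)), so gap-convex is the convexity of f.
gap : ℕ → ℕ
gap m = (m + 2) * num m ∸ den m

gap+den : ∀ m → gap m + den m ≡ (m + 2) * num m
gap+den m = m∸n+n≡m (den≤ m)

gap-convex : ∀ m → gap (suc m) ≤ (suc (suc m) * suc (suc m) + 1) * gap m
gap-convex m = *-cancelˡ-≤ (2 + m) (begin
  (2 + m) * B
    ≡⟨ identity ⟩
  (m + 3) * (m + 1) * m * A + (m * m + 2 * m + 2) * P
    ≤⟨ +-monoʳ-≤ ((m + 3) * (m + 1) * m * A) (*-monoʳ-≤ (m * m + 2 * m + 2) P≤2A) ⟩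
  (m + 3) * (m + 1) * m * A + (m * m + 2 * m + 2) * (2 * A)
    ≤⟨ m≤m+n _ ((6 * m + 6) * A) ⟩
  (m + 3) * (m + 1) * m * A + (m * m + 2 * m + 2) * (2 * A) + (6 * m + 6) * A
    ≡⟨ collect m A ⟩
  (2 + m) * ((suc (suc m) * suc (suc m) + 1) * A)
    ∎)
  where
  open ≤-Reasoning
  A = gap m
  B = gap (suc m)
  P = den m
  Q = num m
  P≤2A : P ≤ 2 * A
  P≤2A = +-cancelʳ-≤ (2 * P) P (2 * A) (begin
    P + 2 * P          ≡⟨⟩
    3 * P              ≤⟨ num-lower m ⟩
    2 * (m + 2) * Q    ≡⟨ *-assoc 2 (m + 2) Q ⟩
    2 * ((m + 2) * Q)  ≡⟨ cong (2 *_) (gap+den m) ⟨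
    2 * (A + P)        ≡⟨ *-distribˡ-+ 2 A P ⟩
    2 * A + 2 * P      ∎)
  X = (2 + m) * ((suc m * suc m + 1) * P)
  identity : (2 + m) * B ≡ (m + 3) * (m + 1) * m * A + (m * m + 2 * m + 2) * P
  identity = +-cancelʳ-≡ X _ _ (begin-equality
    (2 + m) * B + X
      ≡⟨ *-distribˡ-+ (2 + m) B _ ⟨
    (2 + m) * (B + den (suc m))
      ≡⟨ cong ((2 + m) *_) (gap+den (suc m)) ⟩
    (2 + m) * ((suc m + 2) * (P + suc m * m * Q))
      ≡⟨ expand m P Q ⟩
    (2 + m) * (m + 3) * P + (m + 3) * (m + 1) * m * ((m + 2) * Q)
      ≡⟨ cong (λ z → (2 + m) * (m + 3) * P + (m + 3) * (m + 1) * m * z) (gap+den m) ⟨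
    (2 + m) * (m + 3) * P + (m + 3) * (m + 1) * m * (A + P)
      ≡⟨ regroup m P A ⟩
    (m + 3) * (m + 1) * m * A + (m * m + 2 * m + 2) * P + X
      ∎)
    where
    expand : ∀ m p q → (2 + m) * ((suc m + 2) * (p + suc m * m * q))
                       ≡ (2 + m) * (m + 3) * p + (m + 3) * (m + 1) * m * ((m + 2) * q)
    expand = solve-∀
    regroup : ∀ m p a → (2 + m) * (m + 3) * p + (m + 3) * (m + 1) * m * (a + p)
                        ≡ (m + 3) * (m + 1) * m * a + (m * m + 2 * m + 2) * p + (2 + m) * ((suc m * suc m + 1) * p)
    regroup = solve-∀
  collect : ∀ m a → (m + 3) * (m + 1) * m * a + (m * m + 2 * m + 2) * (2 * a) + (6 * m + 6) * a
                    ≡ (2 + m) * ((suc (suc m) * suc (suc m) + 1) * a)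
  collect = solve-∀

-- With g(m) = m f(m), this is g(m+1) − g(m) ≥ 1/(2(m+1)), cleared of denominators.
num-gain : ∀ m →
  2 * suc m * m * (suc m * suc m + 1) * num m + den (suc m) ≤ 2 * suc m * suc m * num (suc m)
num-gain m = +-cancelʳ-≤ (m * (2 * suc m * num m)) _ _ (begin
  2 * suc m * m * (suc m * suc m + 1) * num m + den (suc m) + m * (2 * suc m * num m)
    ≤⟨ +-monoʳ-≤ _ (*-monoʳ-≤ m (num-upper m)) ⟩
  2 * suc m * m * (suc m * suc m + 1) * num m + (suc m * suc m + 1) * den m + m * ((m + 2) * den m)
    ≡⟨ regroup m (den m) (num m) ⟩
  2 * suc m * suc m * (den m + suc m * m * num m) + m * (2 * suc m * num m)
    ∎)
  where
  open ≤-Reasoning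
  regroup : ∀ m p q → 2 * suc m * m * (suc m * suc m + 1) * q + (suc m * suc m + 1) * p + m * ((m + 2) * p)
                      ≡ 2 * suc m * suc m * (p + suc m * m * q) + m * (2 * suc m * q)
  regroup = solve-∀

-- mf-≥ a b m states a / b ≤ m f(m).
mf-≥ : ℕ → ℕ → ℕ → Set
mf-≥ a b m = a * den m ≤ m * num m * b

mf-≥-step : ∀ {a b m} → 2 * suc m ≤ b → mf-≥ a b m → mf-≥ (suc a) b (suc m)
mf-≥-step {a} {b} {m} 2[1+m]≤b a/b≤mf = *-cancelˡ-≤ (2 * suc m) (begin
  2 * suc m * (suc a * den (suc m))
    ≡⟨ distrib (2 * suc m) a (den (suc m)) ⟩
  (2 * suc m * a + 2 * suc m) * den (suc m)
    ≤⟨ *-monoˡ-≤ (den (suc m)) (+-monoʳ-≤ (2 * suc m * a) 2[1+m]≤b) ⟩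
  (2 * suc m * a + b) * den (suc m)
    ≡⟨ unfold m a b (den m) ⟩
  2 * suc m * (suc m * suc m + 1) * (a * den m) + b * den (suc m)
    ≤⟨ +-monoˡ-≤ (b * den (suc m)) (*-monoʳ-≤ (2 * suc m * (suc m * suc m + 1)) a/b≤mf) ⟩
  2 * suc m * (suc m * suc m + 1) * (m * num m * b) + b * den (suc m)
    ≡⟨ factor m b (num m) (den (suc m)) ⟩
  b * (2 * suc m * m * (suc m * suc m + 1) * num m + den (suc m))
    ≤⟨ *-monoʳ-≤ b (num-gain m) ⟩
  b * (2 * suc m * suc m * num (suc m))
    ≡⟨ refactor (suc m) b (num (suc m)) ⟩
  2 * suc m * (suc m * num (suc m) * b)
    ∎)
  where
  open ≤-Reasoning
  distrib : ∀ x a p → x * (suc a * p) ≡ (x * a + x) * p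
  distrib = solve-∀
  unfold : ∀ m a b p → (2 * suc m * a + b) * ((suc m * suc m + 1) * p)
                       ≡ 2 * suc m * (suc m * suc m + 1) * (a * p) + b * ((suc m * suc m + 1) * p)
  unfold = solve-∀
  factor : ∀ m b q r → 2 * suc m * (suc m * suc m + 1) * (m * q * b) + b * r
                       ≡ b * (2 * suc m * m * (suc m * suc m + 1) * q + r)
  factor = solve-∀
  refactor : ∀ x b q → b * (2 * x * x * q) ≡ 2 * x * (x * q * b)
  refactor = solve-∀

mf-≥-+ : ∀ {a b m} t → 2 * (m + t) ≤ b → mf-≥ a b m → mf-≥ (a + t) b (m + t)
mf-≥-+ {a} {b} {m} zero    _          a/b≤mf rewrite +-identityʳ a | +-identityʳ m = a/b≤mf
mf-≥-+ {a} {b} {m} (suc t) 2[m+t+1]≤b a/b≤mf rewrite +-suc a t | +-suc m t =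
  mf-≥-step {a + t} {b} {m + t} 2[m+t+1]≤b
    (mf-≥-+ {a} {b} {m} t (≤-trans (*-monoʳ-≤ 2 (n≤1+n (m + t))) 2[m+t+1]≤b) a/b≤mf)

mf-≥-scale : ∀ {a b m} c → mf-≥ a b m → mf-≥ (c * a) (c * b) m
mf-≥-scale {a} {b} {m} c a/b≤mf = begin
  c * a * den m      ≡⟨ *-assoc c a (den m) ⟩
  c * (a * den m)    ≤⟨ *-monoʳ-≤ c a/b≤mf ⟩
  c * (m * num m * b) ≡⟨ x∙yz≈y∙xz c (m * num m) b ⟩
  m * num m * (c * b) ∎
  where open ≤-Reasoning

mf-≥-pow2 : ∀ J → mf-≥ (suc J * 2 ^ J) (4 * 2 ^ J) (2 ^ J)
mf-≥-pow2 zero    = s≤s (s≤s z≤n)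
mf-≥-pow2 (suc J) =
  cast (regroup J q) (*-comm-2-4 q) (sym (cong (q +_) (+-identityʳ q)))
       (mf-≥-scale {suc J * q + q} {4 * q} {q + q} 2
         (mf-≥-+ {suc J * q} {4 * q} {q} q (≤-reflexive (double q)) (mf-≥-pow2 J)))
  where
  q = 2 ^ J
  cast : ∀ {a a′ b b′ m m′} → a ≡ a′ → b ≡ b′ → m ≡ m′ → mf-≥ a b m → mf-≥ a′ b′ m′
  cast refl refl refl a/b≤mf = a/b≤mf
  regroup : ∀ J q → 2 * (suc J * q + q) ≡ suc (suc J) * (2 * q)
  regroup = solve-∀
  *-comm-2-4 : ∀ q → 2 * (4 * q) ≡ 4 * (2 * q)
  *-comm-2-4 = solve-∀
  double : ∀ q → 2 * (q + q) ≡ 4 * q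
  double = solve-∀

f-log-lower : ∀ J t → t < 2 ^ J → suc J * den (2 ^ J + t) ≤ 4 * (2 ^ J + t) * num (2 ^ J + t)
f-log-lower J t t<q = *-cancelˡ-≤ q {{m^n≢0 2 J}} (begin
  q * (suc J * den D)      ≡⟨ x∙yz≈y∙xz q (suc J) (den D) ⟩
  suc J * (q * den D)      ≡⟨ *-assoc (suc J) q (den D) ⟨
  suc J * q * den D        ≤⟨ *-monoˡ-≤ (den D) (m≤m+n (suc J * q) t) ⟩
  (suc J * q + t) * den D  ≤⟨ mf-≥-+ {suc J * q} {4 * q} {q} t 2D≤4q (mf-≥-pow2 J) ⟩
  D * num D * (4 * q)      ≡⟨ regroup q D (num D) ⟩
  q * (4 * D * num D)      ∎)
  where
  open ≤-Reasoning
  q = 2 ^ J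
  D = q + t
  2D≤4q : 2 * (q + t) ≤ 4 * q
  2D≤4q = begin
    2 * (q + t)  ≤⟨ *-monoʳ-≤ 2 (+-monoʳ-≤ q (<⇒≤ t<q)) ⟩
    2 * (q + q)  ≡⟨ double q ⟩
    4 * q        ∎
    where
    double : ∀ q → 2 * (q + q) ≡ 4 * q
    double = solve-∀
  regroup : ∀ q D x → D * x * (4 * q) ≡ q * (4 * D * x)
  regroup = solve-∀

pow2-split : ∀ D → 1 ≤ D → ∃₂ λ J t → t < 2 ^ J × D ≡ 2 ^ J + t
pow2-split (suc zero)    _ = 0 , 0 , s≤s z≤n , refl
pow2-split (suc (suc D)) _ with pow2-split (suc D) (s≤s z≤n)
... | J , t , t<q , 1+D≡q+t with m≤n⇒m<n∨m≡n t<q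
...   | inj₁ 1+t<q  = J , suc t , 1+t<q , trans (cong suc 1+D≡q+t) (sym (+-suc (2 ^ J) t))
...   | inj₂ 1+t≡q  = suc J , 0 , m^n>0 2 (suc J) , (begin
  suc (suc D)      ≡⟨ cong suc 1+D≡q+t ⟩
  suc (2 ^ J + t)  ≡⟨ +-suc (2 ^ J) t ⟨
  2 ^ J + suc t    ≡⟨ cong (2 ^ J +_) 1+t≡q ⟩
  2 ^ J + 2 ^ J    ≡⟨ cong (λ x → 2 ^ J + x) (+-identityʳ (2 ^ J)) ⟨
  2 ^ suc J        ≡⟨ +-identityʳ (2 ^ suc J) ⟨
  2 ^ suc J + 0    ∎)
  where open ≡-Reasoning

denFrom : ℕ → ℕ → ℕ
denFrom k zero    = 1
denFrom k (suc s) = (suc k * suc k + 1) * denFrom (suc k) s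

den-*-denFrom : ∀ k s → den k * denFrom k s ≡ den (k + s)
den-*-denFrom k zero    = trans (*-identityʳ (den k)) (cong den (sym (+-identityʳ k)))
den-*-denFrom k (suc s) = begin
  den k * ((suc k * suc k + 1) * denFrom (suc k) s)  ≡⟨ x∙yz≈y∙xz (den k) (suc k * suc k + 1) _ ⟩
  (suc k * suc k + 1) * (den k * denFrom (suc k) s)  ≡⟨ *-assoc (suc k * suc k + 1) (den k) _ ⟨
  den (suc k) * denFrom (suc k) s                    ≡⟨ den-*-denFrom (suc k) s ⟩
  den (suc k + s)                                    ≡⟨ cong den (+-suc k s) ⟨
  den (k + suc s)                                    ∎
  where open ≡-Reasoning

-- Shearer's weights scaled by den D: F k = den D · f(k) and ∂F (k + 1) = den D · (f(k) − f(k + 1)).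
shearerWeights : ∀ D → ShearerWeights D (den D)
shearerWeights D = record
  { F = F ; ∂F = ∂F ; F-step = F-step ; ∂F-step = ∂F-step ; recurrence = recurrence }
  where
  F : ℕ → ℕ
  F k = num k * denFrom k (D ∸ k)

  ∂F : ℕ → ℕ
  ∂F zero    = 0
  ∂F (suc k) = denFrom (suc k) (D ∸ suc k) * gap k

  D∸k≡1+D∸[1+k] : ∀ {k} → suc k ≤ D → D ∸ k ≡ suc (D ∸ suc k)
  D∸k≡1+D∸[1+k] = +-∸-assoc 1

  F-step : ∀ {k} → suc k ≤ D → F k ≡ F (suc k) + ∂F (suc k)
  F-step {k} 1+k≤D = begin
    num k * denFrom k (D ∸ k)                          ≡⟨ cong (λ s → num k * denFrom k s) (D∸k≡1+D∸[1+k] 1+k≤D) ⟩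
    num k * ((suc k * suc k + 1) * r)                  ≡⟨ split k (num k) r ⟩
    r * ((k + 2) * num k) + suc k * k * num k * r      ≡⟨ cong (λ x → r * x + suc k * k * num k * r) (gap+den k) ⟨
    r * (gap k + den k) + suc k * k * num k * r        ≡⟨ regroup k (num k) r (gap k) (den k) ⟩
    (den k + suc k * k * num k) * r + r * gap k        ∎
    where
    open ≡-Reasoning
    r = denFrom (suc k) (D ∸ suc k)
    split : ∀ k q r → q * ((suc k * suc k + 1) * r) ≡ r * ((k + 2) * q) + suc k * k * q * r
    split = solve-∀
    regroup : ∀ k q r a p → r * (a + p) + suc k * k * q * r ≡ (p + suc k * k * q) * r + r * a
    regroup = solve-∀

  ∂F-step : ∀ {k} → 1 ≤ k → suc k ≤ D → ∂F (suc k) ≤ ∂F k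
  ∂F-step {suc m} _ 2+m≤D = begin
    r * gap (suc m)                                      ≤⟨ *-monoʳ-≤ r (gap-convex m) ⟩
    r * (c * gap m)                                      ≡⟨ x∙yz≈y∙xz r c (gap m) ⟩
    c * (r * gap m)                                      ≡⟨ *-assoc c r (gap m) ⟨
    denFrom (suc m) (suc (D ∸ suc (suc m))) * gap m
      ≡⟨ cong (λ s → denFrom (suc m) s * gap m) (D∸k≡1+D∸[1+k] 2+m≤D) ⟨
    denFrom (suc m) (D ∸ suc m) * gap m                  ∎
    where
    open ≤-Reasoning
    r = denFrom (suc (suc m)) (D ∸ suc (suc m))
    c = suc (suc m) * suc (suc m) + 1

  recurrence : ∀ {k} → k ≤ D → suc k * F k ≤ den D + k * (k ∸ 1) * ∂F k
  recurrence {zero}  _      = ≤-reflexive (trans (*-identityˡ _) (trans (den-*-denFrom 0 D) (sym (+-identityʳ (den D)))))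
  recurrence {suc m} 1+m≤D = ≤-reflexive (begin
    (2 + m) * ((P + suc m * m * Q) * r)                 ≡⟨ expand m P Q r ⟩
    (m + 2) * P * r + suc m * m * ((m + 2) * Q) * r     ≡⟨ cong (λ x → (m + 2) * P * r + suc m * m * x * r) (gap+den m) ⟨
    (m + 2) * P * r + suc m * m * (gap m + P) * r       ≡⟨ regroup m P r (gap m) ⟩
    den (suc m) * r + suc m * m * (r * gap m)           ≡⟨ cong (_+ suc m * m * (r * gap m)) den[1+m]*r≡den[D] ⟩
    den D + suc m * m * (r * gap m)                     ∎)
    where
    open ≡-Reasoning
    P = den m
    Q = num m
    r = denFrom (suc m) (D ∸ suc m)
    den[1+m]*r≡den[D] : den (suc m) * r ≡ den D
    den[1+m]*r≡den[D] = trans (den-*-denFrom (suc m) (D ∸ suc m)) (cong den (m+[n∸m]≡n 1+m≤D))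
    expand : ∀ m p q r → (2 + m) * ((p + suc m * m * q) * r) ≡ (m + 2) * p * r + suc m * m * ((m + 2) * q) * r
    expand = solve-∀
    regroup : ∀ m p r a → (m + 2) * p * r + suc m * m * (a + p) * r
                          ≡ (suc m * suc m + 1) * p * r + suc m * m * (r * a)
    regroup = solve-∀

-- Degenerate graphs and the low-degree part of U

module _ (G : SimpleGraph n) where

  open GraphNotation G

  subDegree-tabulate : ∀ W v → subDegree (tabulate W) (adj G) v ≡ deg W v
  subDegree-tabulate W v = trans (size-tabulate (λ u → lookup (tabulate W) u ∧ adj G v u))
    (sum-cong-≗ (λ u → cong (λ b → 𝟙 (b ∧ adj G v u) * 1) (lookup∘tabulate W u)))

  degenerate-min-deg : ∀ {d} → Degenerate d G → ∀ W {v₀} → T (W v₀) → ∃ λ v → T (W v) × deg W v ≤ d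
  degenerate-min-deg {d} d-deg W {v₀} v₀∈W
    with d-deg (tabulate W) (adj G) (λ _ _ u~v → u~v) (SimpleGraph.sym G) (v₀ , T⇒∈tabulate W v₀∈W)
  ... | v , v∈ , subdeg≤d = v , ∈tabulate⇒T W v∈ , subst (_≤ d) (subDegree-tabulate W v) subdeg≤d

  ∑-deg≤-degenerate-bounded : ∀ {d} → Degenerate d G → ∀ s W → size W ≤ s →
                              ∑[ u ∈ W ] deg W u ≤ 2 * d * size W
  ∑-deg≤-degenerate-bounded d-deg s W |W|≤s with any? (T? ∘ W)
  ... | no W-empty = ≤-trans (≤-reflexive ∑≡0) z≤n
    where
    ∑≡0 : ∑[ u ∈ W ] deg W u ≡ 0
    ∑≡0 = ∑∈-empty W _ (λ u u∈W → W-empty (u , u∈W))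
  ∑-deg≤-degenerate-bounded d-deg zero W |W|≤0 | yes (v₀ , v₀∈W) =
    ⊥-elim (<⇒≱ (size-nonempty W v₀∈W) |W|≤0)
  ∑-deg≤-degenerate-bounded {d} d-deg (suc s) W |W|≤1+s | yes (v₀ , v₀∈W)
    with degenerate-min-deg d-deg W v₀∈W
  ... | v , v∈W , dv≤d = begin
    ∑[ u ∈ W ] deg W u
      ≤⟨ ∑∈-⊆ W (⁅ v ⁆ ∪ W′) (deg W) (⊆⁅⁆∪∖⁅⁆ W v) ⟩
    ∑[ u ∈ ⁅ v ⁆ ∪ W′ ] deg W u
      ≤⟨ ∑∈-∪ ⁅ v ⁆ W′ (deg W) ⟩
    ∑[ u ∈ ⁅ v ⁆ ] deg W u + ∑[ u ∈ W′ ] deg W u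
      ≡⟨ cong (_+ ∑[ u ∈ W′ ] deg W u) (∑∈-⁅⁆ v (deg W)) ⟩
    deg W v + ∑[ u ∈ W′ ] deg W u
      ≤⟨ +-monoʳ-≤ (deg W v) (∑∈-mono-≤ W′ (λ {u} _ → deg≤ u)) ⟩
    deg W v + ∑[ u ∈ W′ ] (deg ⁅ v ⁆ u + deg W′ u)
      ≡⟨ cong (deg W v +_) (∑∈-distrib-+ W′ (deg ⁅ v ⁆) (deg W′)) ⟩
    deg W v + (∑[ u ∈ W′ ] deg ⁅ v ⁆ u + ∑[ u ∈ W′ ] deg W′ u)
      ≡⟨ cong (λ x → deg W v + (x + ∑[ u ∈ W′ ] deg W′ u)) ∑-deg-⁅v⁆ ⟩
    deg W v + (deg W′ v + ∑[ u ∈ W′ ] deg W′ u)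
      ≤⟨ +-mono-≤ dv≤d (+-mono-≤ d′v≤d (∑-deg≤-degenerate-bounded d-deg s W′ |W′|≤s)) ⟩
    d + (d + 2 * d * size W′)
      ≡⟨ regroup d (size W′) ⟩
    2 * d * suc (size W′)
      ≤⟨ *-monoʳ-≤ (2 * d) (size-∖ W ⁅ v ⁆ v∈W (v∈⁅v⁆ v)) ⟩
    2 * d * size W
      ∎
    where
    open ≤-Reasoning
    W′ = W ∖ ⁅ v ⁆
    deg≤ : ∀ u → deg W u ≤ deg ⁅ v ⁆ u + deg W′ u
    deg≤ u = ≤-trans (deg-mono W (⁅ v ⁆ ∪ W′) u (⊆⁅⁆∪∖⁅⁆ W v)) (deg-∪ ⁅ v ⁆ W′ u)
    ∑-deg-⁅v⁆ : ∑[ u ∈ W′ ] deg ⁅ v ⁆ u ≡ deg W′ v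
    ∑-deg-⁅v⁆ = trans (∑-deg-comm W′ ⁅ v ⁆) (∑∈-⁅⁆ v (deg W′))
    d′v≤d : deg W′ v ≤ d
    d′v≤d = ≤-trans (deg-mono W′ W v ∧-fst) dv≤d
    |W′|≤s : size W′ ≤ s
    |W′|≤s = ≤-pred (≤-trans (size-∖ W ⁅ v ⁆ v∈W (v∈⁅v⁆ v)) |W|≤1+s)
    regroup : ∀ d w → d + (d + 2 * d * w) ≡ 2 * d * suc w
    regroup = solve-∀

  ∑-deg≤-degenerate : ∀ {d} → Degenerate d G → ∀ W → ∑[ u ∈ W ] deg W u ≤ 2 * d * size W
  ∑-deg≤-degenerate d-deg W = ∑-deg≤-degenerate-bounded d-deg (size W) W ≤-refl

  degree≤ : ℕ → VSet n → VSet n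
  degree≤ D U u = deg U u ≤ᵇ D

  size≤2*size-degree≤ : ∀ {d} → Degenerate d G → ∀ U → size U ≤ 2 * size (U ∩ degree≤ (4 * d) U)
  size≤2*size-degree≤ {d} d-deg U = begin
    size U   ≡⟨ ∑∈-split U L (λ _ → 1) ⟩
    w + b    ≤⟨ +-monoʳ-≤ w b≤w ⟩
    w + w    ≡⟨ cong (w +_) (+-identityʳ w) ⟨
    2 * w    ∎
    where
    open ≤-Reasoning
    L = degree≤ (4 * d) U
    w = size (U ∩ L)
    b = size (U ∖ L)
    high : ∀ {u} → T ((U ∖ L) u) → 4 * d < deg U u
    high u∈ = ≰⇒> (λ du≤4d → T-not⇒¬T (∧-snd u∈) (≤⇒≤ᵇ du≤4d))
    high-degrees : suc (4 * d) * b ≤ 2 * d * (w + b)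
    high-degrees = begin
      suc (4 * d) * b              ≡⟨ *-comm (suc (4 * d)) b ⟩
      b * suc (4 * d)              ≡⟨ ∑∈-const (U ∖ L) (suc (4 * d)) ⟨
      ∑[ u ∈ U ∖ L ] suc (4 * d)   ≤⟨ ∑∈-mono-≤ (U ∖ L) high ⟩
      ∑[ u ∈ U ∖ L ] deg U u       ≤⟨ ∑∈-⊆ (U ∖ L) U (deg U) ∧-fst ⟩
      ∑[ u ∈ U ] deg U u           ≤⟨ ∑-deg≤-degenerate d-deg U ⟩
      2 * d * size U               ≡⟨ cong (2 * d *_) (∑∈-split U L (λ _ → 1)) ⟩
      2 * d * (w + b)              ∎
    b≤w : b ≤ w
    b≤w = *-cancelˡ-≤ (suc (2 * d)) (≤-trans (+-cancelʳ-≤ (2 * d * b) _ _ (begin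
      suc (2 * d) * b + 2 * d * b  ≡⟨ regroup d b ⟩
      suc (4 * d) * b              ≤⟨ high-degrees ⟩
      2 * d * (w + b)              ≡⟨ *-distribˡ-+ (2 * d) w b ⟩
      2 * d * w + 2 * d * b        ∎)) (*-monoˡ-≤ w (n≤1+n (2 * d))))
      where
      regroup : ∀ d b → suc (2 * d) * b + 2 * d * b ≡ suc (4 * d) * b
      regroup = solve-∀

  shearer-bound : TriangleFree G → ∀ D W a → MaxDegree≤ D W →
    (∀ I → I ⊆ W → IsIndependent I → size I ≤ a) → size W * num D ≤ den D * a
  shearer-bound △-free D W a Δ α-bound with Shearer.shearer G △-free (shearerWeights D) W Δ
  ... | I , I⊆W , I-indep , ΦW≤ = begin
    size W * num D         ≡⟨ cong (size W *_) F[D]≡num[D] ⟨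
    size W * F D           ≤⟨ size*F[D]≤Φ W Δ ⟩
    Φ W                    ≤⟨ ΦW≤ ⟩
    den D * size I         ≤⟨ *-monoʳ-≤ (den D) (α-bound I I⊆W I-indep) ⟩
    den D * a              ∎
    where
    open ≤-Reasoning
    open Shearer G △-free (shearerWeights D)
    open ShearerWeights (shearerWeights D) using (F)
    F[D]≡num[D] : F D ≡ num D
    F[D]≡num[D] = trans (cong (λ s → num D * denFrom D s) (n∸n≡0 D)) (*-identityʳ (num D))

  log-bound : TriangleFree G → ∀ {d a} J t U → Degenerate d G → 4 * d ≡ 2 ^ J + t → t < 2 ^ J →
    (∀ I → I ⊆ U → IsIndependent I → size I ≤ a) → suc J * size U ≤ 32 * d * a
  log-bound △-free {d} {a} J t U d-deg 4d≡2^J+t t<2^J α-bound = begin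
    suc J * size U         ≤⟨ *-monoʳ-≤ (suc J) (size≤2*size-degree≤ d-deg U) ⟩
    suc J * (2 * size W)   ≡⟨ x∙yz≈y∙xz (suc J) 2 (size W) ⟩
    2 * (suc J * size W)   ≤⟨ *-monoʳ-≤ 2 J*|W|≤4Da ⟩
    2 * (4 * D * a)        ≡⟨ regroup d a ⟩
    32 * d * a             ∎
    where
    open ≤-Reasoning
    D = 4 * d
    W = U ∩ degree≤ D U
    Δ : MaxDegree≤ D W
    Δ {u} u∈W = ≤-trans (deg-mono W U u ∧-fst) (≤ᵇ⇒≤ (deg U u) D (∧-snd u∈W))
    α-bound-W : ∀ I → I ⊆ W → IsIndependent I → size I ≤ a
    α-bound-W I I⊆W = α-bound I (∧-fst ∘ I⊆W)
    J*den≤4D*num : suc J * den D ≤ 4 * D * num D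
    J*den≤4D*num = subst (λ m → suc J * den m ≤ 4 * m * num m) (sym 4d≡2^J+t) (f-log-lower J t t<2^J)
    J*|W|≤4Da : suc J * size W ≤ 4 * D * a
    J*|W|≤4Da = *-cancelʳ-≤ (suc J * size W) (4 * D * a) (den D) {{>-nonZero (1≤den D)}} (begin
      suc J * size W * den D     ≡⟨ *-comm-middle (suc J) (size W) (den D) ⟩
      size W * (suc J * den D)   ≤⟨ *-monoʳ-≤ (size W) J*den≤4D*num ⟩
      size W * (4 * D * num D)   ≡⟨ x∙yz≈y∙xz (size W) (4 * D) (num D) ⟩
      4 * D * (size W * num D)   ≤⟨ *-monoʳ-≤ (4 * D) (shearer-bound △-free D W a Δ α-bound-W) ⟩
      4 * D * (den D * a)        ≡⟨ cong (4 * D *_) (*-comm (den D) a) ⟩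
      4 * D * (a * den D)        ≡⟨ *-assoc (4 * D) a (den D) ⟨
      4 * D * a * den D          ∎)
      where
      *-comm-middle : ∀ j w p → j * w * p ≡ w * (j * p)
      *-comm-middle = solve-∀
    regroup : ∀ d a → 2 * (4 * (4 * d) * a) ≡ 32 * d * a
    regroup = solve-∀

  α-bound : ∀ {U a} → IsIndependenceNumber G U a → ∀ I → I ⊆ lookup U → IsIndependent I → size I ≤ a
  α-bound {U} (_ , maximal) I I⊆U I-indep = subst (_≤ _) (size-tabulate I) (maximal (tabulate I) (⊆U , indep))
    where
    ⊆U : tabulate I Subset.⊆ U
    ⊆U x∈ = T⇒∈ (I⊆U (∈tabulate⇒T I x∈))
    indep : ∀ u v → u Subset.∈ tabulate I → v Subset.∈ tabulate I → adj G u v ≡ false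
    indep u v u∈ v∈ = I-indep (∈tabulate⇒T I u∈) (∈tabulate⇒T I v∈)

-- From log₂ to the truncated logarithm

n!≤nⁿ : ∀ n → n ! ≤ n ^ n
n!≤nⁿ zero    = ≤-refl
n!≤nⁿ (suc n) = *-monoʳ-≤ (suc n) (≤-trans (n!≤nⁿ n) (^-monoˡ-≤ n (n≤1+n n)))

^-distribʳ-* : ∀ m n k → (m * n) ^ k ≡ m ^ k * n ^ k
^-distribʳ-* m n zero    = refl
^-distribʳ-* m n (suc k) = trans (cong (m * n *_) (^-distribʳ-* m n k)) (shuffle m n (m ^ k) (n ^ k))
  where
  shuffle : ∀ m n a b → m * n * (a * b) ≡ m * a * (n * b)
  shuffle = solve-∀

^≤expSum : ∀ m N → m ^ N ≤ expSum m N
^≤expSum m zero    = ≤-refl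
^≤expSum m (suc N) = m≤n+m (m ^ suc N) (suc N * expSum m N)

≤2*-from-suc*≤ : ∀ {x N} J → suc J * x ≤ N → x ≤ 2 * N
≤2*-from-suc*≤ {x} {N} J Jx≤N = ≤-trans (m≤n*m x (suc J)) (≤-trans Jx≤N (m≤m+n N _))

-- For d ≥ 3 the witness is N: d ^ x ≤ 2 ^ N and N ! ≤ N ^ N, so d ^ x · N ! ≤ (2N) ^ N, one term of e ^ 2N.
mulLogLe-from-log₂ : ∀ {x d N} J → d ≤ 2 ^ suc J → suc J * x ≤ N → MulLogLe x d (2 * N)
mulLogLe-from-log₂ {d = zero}          J _ = ≤2*-from-suc*≤ J
mulLogLe-from-log₂ {d = suc zero}      J _ = ≤2*-from-suc*≤ J
mulLogLe-from-log₂ {d = suc (suc zero)} J _ = ≤2*-from-suc*≤ J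
mulLogLe-from-log₂ {x} {d@(suc (suc (suc _)))} {N} J d≤2^[1+J] Jx≤N = N , (begin
  d ^ x * N !          ≤⟨ *-mono-≤ d^x≤2^N (n!≤nⁿ N) ⟩
  2 ^ N * N ^ N        ≡⟨ ^-distribʳ-* 2 N N ⟨
  (2 * N) ^ N          ≤⟨ ^≤expSum (2 * N) N ⟩
  expSum (2 * N) N     ∎)
  where
  open ≤-Reasoning
  d^x≤2^N : d ^ x ≤ 2 ^ N
  d^x≤2^N = begin
    d ^ x                ≤⟨ ^-monoˡ-≤ x d≤2^[1+J] ⟩
    (2 ^ suc J) ^ x      ≡⟨ ^-*-assoc 2 (suc J) x ⟩
    2 ^ (suc J * x)      ≤⟨ ^-monoʳ-≤ 2 Jx≤N ⟩
    2 ^ N                ∎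

proposition6p3 : Σ ℕ λ C → 0 < C ×
    ((d : ℕ) → 1 ≤ d → (n : ℕ) (G : SimpleGraph n) →
     TriangleFree G → Degenerate d G →
     (U : Subset n) → Nonempty U → (a : ℕ) → IsIndependenceNumber G U a →
     MulLogLe ∣ U ∣ d (C * d * a))
proposition6p3 = 64 , s≤s z≤n , hall-ratio
  where
  hall-ratio : ∀ d → 1 ≤ d → ∀ n (G : SimpleGraph n) → TriangleFree G → Degenerate d G →
               ∀ U → Nonempty U → ∀ a → IsIndependenceNumber G U a → MulLogLe ∣ U ∣ d (64 * d * a)
  hall-ratio d 1≤d n G △-free d-deg U _ a α-U with pow2-split (4 * d) (≤-trans 1≤d (m≤n*m d 4))
  ... | J , t , t<2^J , 4d≡2^J+t =
    subst (MulLogLe ∣ U ∣ d) (double d a) (mulLogLe-from-log₂ J d≤2^[1+J] J*|U|≤32da)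
    where
    J*|U|≤32da : suc J * ∣ U ∣ ≤ 32 * d * a
    J*|U|≤32da = subst (λ s → suc J * s ≤ 32 * d * a) (sym (size-lookup U))
                   (log-bound G △-free J t (lookup U) d-deg 4d≡2^J+t t<2^J (α-bound G α-U))
    d≤2^[1+J] : d ≤ 2 ^ suc J
    d≤2^[1+J] = begin
      d              ≤⟨ m≤n*m d 4 ⟩
      4 * d          ≡⟨ 4d≡2^J+t ⟩
      2 ^ J + t      ≤⟨ +-monoʳ-≤ (2 ^ J) (<⇒≤ t<2^J) ⟩
      2 ^ J + 2 ^ J  ≡⟨ cong (2 ^ J +_) (+-identityʳ (2 ^ J)) ⟨
      2 ^ suc J      ∎
      where open ≤-Reasoning
    double : ∀ d a → 2 * (32 * d * a) ≡ 64 * d * a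
    double = solve-∀
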